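{- The following group equality holds $H_n=L_{n-1}\times L_{n-1}^{x_n}\times L_{n-1}^{x_n^2}$.
   Context: Let $\mathcal{T}$ be the rooted $3$-ary tree whose vertices are words over $X=\{0,1,2\}$, and $\mathcal{T}_n$ its truncation at level $n$. Via sections, $\mathrm{Aut}(\mathcal{T}_n)\cong(\mathrm{Aut}(\mathcal{T}_{n-1})^3)\rtimes S_3$, and an element is written $(\sigma_0,\sigma_1,\sigma_2)\pi$ with $\sigma_i\in\mathrm{Aut}(\mathcal{T}_{n-1})$ and $\pi\in S_3$. $\mathrm{Aut}(\mathcal{T}_{n-1})$ is embedded in $\mathrm{Aut}(\mathcal{T}_n)$ by $\sigma\mapsto(\sigma,\mathrm{id},\mathrm{id})$. Define recursively $x_1=(0,1,2)$, $y_1=(0,1)$, $z_1=\mathrm{id}$ in $S_3=\mathrm{Aut}(\mathcal{T}_1)$, and for $n\ge2$: $x_n=(\mathrm{id},\mathrm{id},x_{n-1})(0,1,2)$, $y_n=(\mathrm{id},y_{n-1},x_{n-1})(0,1)$, $z_n=(y_{n-1},y_{n-1},x_{n-1})$. Let $L_0$ be trivial, $L_n=\langle x_n,z_n,L_{n-1}\rangle$, $M_n=\langle x_n,y_n,z_n,L_{n-1}\rangle$, and let $H_n=\langle L_{n-1}\rangle^{L_n}$ be the normal closure of $L_{n-1}$ in $L_n$. Here $L_{n-1}^{x_n}$ denotes the conjugate of $L_{n-1}$ by $x_n$. -}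

module Defs where

open import Data.Nat using (ℕ; zero; suc)
open import Data.Fin using (Fin; zero; suc)
open import Data.Unit using (⊤; tt)
open import Data.Empty using (⊥)
open import Data.Sum using (_⊎_)
open import Data.Product using (Σ; ∃; ∃-syntax; _×_; _,_)
open import Relation.Binary.PropositionalEquality using (_≡_)

data S3 : Set where
  e r r² t01 t02 t12 : S3

app : S3 → Fin 3 → Fin 3
app e   i = i
app r   zero = suc zero
app r   (suc zero) = suc (suc zero)
app r   (suc (suc zero)) = zero
app r²  zero = suc (suc zero)
app r²  (suc zero) = zero
app r²  (suc (suc zero)) = suc zero
app t01 zero = suc zero
app t01 (suc zero) = zero
app t01 (suc (suc zero)) = suc (suc zero)
app t02 zero = suc (suc zero)
app t02 (suc zero) = suc zero
app t02 (suc (suc zero)) = zero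
app t12 zero = zero
app t12 (suc zero) = suc (suc zero)
app t12 (suc (suc zero)) = suc zero

-- the permutation sending 0 ↦ i, 1 ↦ j (i ≠ j; the degenerate case is never used)
fromImages : Fin 3 → Fin 3 → S3
fromImages zero (suc zero) = e
fromImages zero (suc (suc zero)) = t12
fromImages (suc zero) zero = t01
fromImages (suc zero) (suc (suc zero)) = r
fromImages (suc (suc zero)) zero = r²
fromImages (suc (suc zero)) (suc zero) = t02
fromImages _ _ = e

-- Right-action convention: π ∘₃ ρ means "first π, then ρ".
_∘₃_ : S3 → S3 → S3
π ∘₃ ρ = fromImages (app ρ (app π zero)) (app ρ (app π (suc zero)))

inv₃ : S3 → S3
inv₃ e = e
inv₃ r = r²
inv₃ r² = r
inv₃ t01 = t01
inv₃ t02 = t02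
inv₃ t12 = t12

-- Aut(𝒯ₙ) via sections: Aut(𝒯₀) trivial, Aut(𝒯ₙ₊₁) ≅ Aut(𝒯ₙ)³ ⋊ S₃.
-- node g₀ g₁ g₂ π  represents  (g₀,g₁,g₂)π, acting on the right:
--   (x w)^g = x^π · w^{g_x}.

record Node (A : Set) : Set where
  constructor node
  field
    s₀ s₁ s₂ : A
    perm : S3

Aut : ℕ → Set
Aut zero = ⊤
Aut (suc n) = Node (Aut n)

sec : {A : Set} → Node A → Fin 3 → A
sec (node a b c _) zero = a
sec (node a b c _) (suc zero) = b
sec (node a b c _) (suc (suc zero)) = c

idA : (n : ℕ) → Aut n
idA zero = tt
idA (suc n) = node (idA n) (idA n) (idA n) e

mulA : (n : ℕ) → Aut n → Aut n → Aut n
mulA zero _ _ = tt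
mulA (suc n) (node g₀ g₁ g₂ π) h =
  node (mulA n g₀ (sec h (app π zero)))
       (mulA n g₁ (sec h (app π (suc zero))))
       (mulA n g₂ (sec h (app π (suc (suc zero)))))
       (π ∘₃ Node.perm h)

invA : (n : ℕ) → Aut n → Aut n
invA zero _ = tt
invA (suc n) g@(node _ _ _ π) =
  node (invA n (sec g (app (inv₃ π) zero)))
       (invA n (sec g (app (inv₃ π) (suc zero))))
       (invA n (sec g (app (inv₃ π) (suc (suc zero)))))
       (inv₃ π)

conj : (n : ℕ) → Aut n → Aut n → Aut n
conj n g h = mulA n (mulA n (invA n h) g) h

emb : (n : ℕ) → Aut n → Aut (suc n)
emb n σ = node σ (idA n) (idA n) e

Pred : ℕ → Set₁
Pred n = Aut n → Set

data Gen {n : ℕ} (S : Pred n) : Pred n where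
  gen  : ∀ {g} → S g → Gen S g
  gone : Gen S (idA n)
  gmul : ∀ {g h} → Gen S g → Gen S h → Gen S (mulA n g h)
  ginv : ∀ {g} → Gen S g → Gen S (invA n g)

NormalClosure : {n : ℕ} → Pred n → Pred n → Pred n
NormalClosure {n} S G = Gen (λ g → ∃[ s ] ∃[ h ] (S s × G h × g ≡ conj n s h))

ConjSub : {n : ℕ} → Pred n → Aut n → Pred n
ConjSub {n} S h g = ∃[ s ] (S s × g ≡ conj n s h)

Emb : {n : ℕ} → Pred n → Pred (suc n)
Emb {n} S g = ∃[ s ] (S s × g ≡ emb n s)

-- The generators. Indexing: xₛ m = x_{m+1}, yₛ m = y_{m+1}, zₛ m = z_{m+1},
-- all in Aut(𝒯_{m+1}).

xₛ : (m : ℕ) → Aut (suc m)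
xₛ zero = node tt tt tt r
xₛ (suc m) = node (idA (suc m)) (idA (suc m)) (xₛ m) r

yₛ : (m : ℕ) → Aut (suc m)
yₛ zero = node tt tt tt t01
yₛ (suc m) = node (idA (suc m)) (yₛ m) (xₛ m) t01

zₛ : (m : ℕ) → Aut (suc m)
zₛ zero = idA 1
zₛ (suc m) = node (yₛ m) (yₛ m) (xₛ m) e

L : (n : ℕ) → Pred n
L zero = Gen (λ _ → ⊥)
L (suc m) = Gen (λ g → (g ≡ xₛ m) ⊎ (g ≡ zₛ m) ⊎ Emb (L m) g)

-- H_{m+1} = ⟨L_m⟩^{L_{m+1}}
H : (m : ℕ) → Pred (suc m)
H m = NormalClosure (Emb (L m)) (L (suc m))

record IsInternalDirectProduct3 {n : ℕ} (G A B C : Pred n) : Set where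
  field
    A⊆G : ∀ {a} → A a → G a
    B⊆G : ∀ {b} → B b → G b
    C⊆G : ∀ {c} → C c → G c
    commAB : ∀ {a b} → A a → B b → mulA n a b ≡ mulA n b a
    commAC : ∀ {a c} → A a → C c → mulA n a c ≡ mulA n c a
    commBC : ∀ {b c} → B b → C c → mulA n b c ≡ mulA n c b
    decomp : ∀ {g} → G g →
      ∃[ a ] ∃[ b ] ∃[ c ] (A a × B b × C c × g ≡ mulA n (mulA n a b) c)
    unique : ∀ {a b c a′ b′ c′} → A a → B b → C c → A a′ → B b′ → C c′ →
      mulA n (mulA n a b) c ≡ mulA n (mulA n a′ b′) c′ →
      (a ≡ a′) × (b ≡ b′) × (c ≡ c′)

{-# OPTIONS --safe #-}
module Submission where

-- Every element of L_{m+1} has all its sections in the normalizer of L_m. For the generators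
-- x_{m+1} = (1,1,x_m)(0,1,2), z_{m+1} = (y_m,y_m,x_m) and (s,1,1) the only nontrivial case is
-- that y_m normalizes L_m; this is checked on the generators of L_m by computing their conjugates,
-- and conjugation by y_m⁻¹ reduces to it because y_m² ∈ L_m. Hence conjugating (s,1,1), s ∈ L_m,
-- by L_{m+1} stays in the group L_m³ of level-one-fixing elements with sections in L_m, so
-- H_{m+1} ⊆ L_m³. Conversely (s,1,1)^x = (1,s,1) and (s,1,1)^{x²} = (1,1,s): the three conjugates
-- of L_m are the coordinate copies of L_m in L_m³, which commute and factor L_m³ uniquely.

open import Defs
open import Algebra.Bundles using (Group)
import Algebra.Properties.Group as GroupProperties
import Algebra.Properties.Monoid as MonoidProperties
open import Data.Empty using (⊥-elim)
open import Data.Fin using (Fin; zero; suc)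
open import Data.Fin.Properties using (all?; _≟_)
open import Data.Nat using (ℕ; zero; suc)
open import Data.Sum using (_⊎_; inj₁; inj₂)
open import Data.Product using (∃-syntax; _×_; _,_; proj₁; proj₂)
open import Function using (_∘_)
open import Level using (0ℓ)
open import Relation.Binary.PropositionalEquality
open import Relation.Nullary.Decidable using (Dec; from-yes; map′)
open import Relation.Unary using (Decidable; _⊆_)

open Node

s3 : Fin 6 → S3
s3 zero = e
s3 (suc zero) = r
s3 (suc (suc zero)) = r²
s3 (suc (suc (suc zero))) = t01
s3 (suc (suc (suc (suc zero)))) = t02
s3 (suc (suc (suc (suc (suc zero))))) = t12

s3-surjective : ∀ π → ∃[ i ] s3 i ≡ π
s3-surjective e = zero , refl
s3-surjective r = suc zero , refl
s3-surjective r² = suc (suc zero) , refl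
s3-surjective t01 = suc (suc (suc zero)) , refl
s3-surjective t02 = suc (suc (suc (suc zero))) , refl
s3-surjective t12 = suc (suc (suc (suc (suc zero)))) , refl

all-S3? : {P : S3 → Set} → Decidable P → Dec (∀ π → P π)
all-S3? {P} P? = map′ (λ ∀P π → let (i , s3i≡π) = s3-surjective π in subst P s3i≡π (∀P i))
                      (λ ∀P i → ∀P (s3 i))
                      (all? (P? ∘ s3))

app-∘₃ : ∀ π σ i → app (π ∘₃ σ) i ≡ app σ (app π i)
app-∘₃ = from-yes (all-S3? λ π → all-S3? λ σ → all? λ i → app (π ∘₃ σ) i ≟ app σ (app π i))

app-inv₃ˡ : ∀ π i → app (inv₃ π) (app π i) ≡ i
app-inv₃ˡ = from-yes (all-S3? λ π → all? λ i → app (inv₃ π) (app π i) ≟ i)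

app-inv₃ʳ : ∀ π i → app π (app (inv₃ π) i) ≡ i
app-inv₃ʳ = from-yes (all-S3? λ π → all? λ i → app π (app (inv₃ π) i) ≟ i)

fromImages-app : ∀ π → fromImages (app π zero) (app π (suc zero)) ≡ π
fromImages-app e = refl
fromImages-app r = refl
fromImages-app r² = refl
fromImages-app t01 = refl
fromImages-app t02 = refl
fromImages-app t12 = refl

∘₃-assoc : ∀ π σ τ → (π ∘₃ σ) ∘₃ τ ≡ π ∘₃ (σ ∘₃ τ)
∘₃-assoc π σ τ = cong₂ fromImages (images zero) (images (suc zero))
  where
  images : ∀ i → app τ (app (π ∘₃ σ) i) ≡ app (σ ∘₃ τ) (app π i)
  images i = trans (cong (app τ) (app-∘₃ π σ i)) (sym (app-∘₃ σ τ (app π i)))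

e-∘₃ : ∀ π → e ∘₃ π ≡ π
e-∘₃ = fromImages-app

∘₃-e : ∀ π → π ∘₃ e ≡ π
∘₃-e = fromImages-app

inv₃-∘₃ : ∀ π → inv₃ π ∘₃ π ≡ e
inv₃-∘₃ π = cong₂ fromImages (app-inv₃ʳ π zero) (app-inv₃ʳ π (suc zero))

∘₃-inv₃ : ∀ π → π ∘₃ inv₃ π ≡ e
∘₃-inv₃ π = cong₂ fromImages (app-inv₃ˡ π zero) (app-inv₃ˡ π (suc zero))

infixl 7 _∙_
infix 9 _⁻¹

_∙_ : ∀ {n} → Aut n → Aut n → Aut n
_∙_ {n} = mulA n

_⁻¹ : ∀ {n} → Aut n → Aut n
_⁻¹ {n} = invA n

ε : ∀ {n} → Aut n
ε {n} = idA n

node-ext : ∀ {A : Set} {g h : Node A} → (∀ i → sec g i ≡ sec h i) → perm g ≡ perm h → g ≡ h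
node-ext {g = node _ _ _ _} {node _ _ _ _} sec≡ refl
  rewrite sec≡ zero | sec≡ (suc zero) | sec≡ (suc (suc zero)) = refl

sec-∙ : ∀ {n} (g h : Aut (suc n)) i → sec (g ∙ h) i ≡ sec g i ∙ sec h (app (perm g) i)
sec-∙ g h zero = refl
sec-∙ g h (suc zero) = refl
sec-∙ g h (suc (suc zero)) = refl

sec-⁻¹ : ∀ {n} (g : Aut (suc n)) i → sec (g ⁻¹) i ≡ sec g (app (inv₃ (perm g)) i) ⁻¹
sec-⁻¹ g zero = refl
sec-⁻¹ g (suc zero) = refl
sec-⁻¹ g (suc (suc zero)) = refl

sec-ε : ∀ {n} i → sec (ε {suc n}) i ≡ ε
sec-ε zero = refl
sec-ε (suc zero) = refl
sec-ε (suc (suc zero)) = refl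

∙-assoc : ∀ {n} (a b c : Aut n) → (a ∙ b) ∙ c ≡ a ∙ (b ∙ c)
∙-assoc {zero} _ _ _ = refl
∙-assoc {suc n} a b c = node-ext sections (∘₃-assoc (perm a) (perm b) (perm c))
  where
  open ≡-Reasoning
  π σ : S3
  π = perm a
  σ = perm b
  sections : ∀ i → sec ((a ∙ b) ∙ c) i ≡ sec (a ∙ (b ∙ c)) i
  sections i = begin
    sec ((a ∙ b) ∙ c) i                                        ≡⟨ sec-∙ (a ∙ b) c i ⟩
    sec (a ∙ b) i ∙ sec c (app (π ∘₃ σ) i)
      ≡⟨ cong₂ _∙_ (sec-∙ a b i) (cong (sec c) (app-∘₃ π σ i)) ⟩
    (sec a i ∙ sec b (app π i)) ∙ sec c (app σ (app π i))      ≡⟨ ∙-assoc _ _ _ ⟩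
    sec a i ∙ (sec b (app π i) ∙ sec c (app σ (app π i)))      ≡⟨ cong (sec a i ∙_) (sec-∙ b c (app π i)) ⟨
    sec a i ∙ sec (b ∙ c) (app π i)                            ≡⟨ sec-∙ a (b ∙ c) i ⟨
    sec (a ∙ (b ∙ c)) i                                        ∎

∙-identityˡ : ∀ {n} (g : Aut n) → ε ∙ g ≡ g
∙-identityˡ {zero} _ = refl
∙-identityˡ {suc n} g = node-ext sections (e-∘₃ (perm g))
  where
  sections : ∀ i → sec (ε ∙ g) i ≡ sec g i
  sections i = trans (sec-∙ ε g i) (trans (cong (_∙ sec g i) (sec-ε i)) (∙-identityˡ (sec g i)))

∙-identityʳ : ∀ {n} (g : Aut n) → g ∙ ε ≡ g
∙-identityʳ {zero} _ = refl
∙-identityʳ {suc n} g = node-ext sections (∘₃-e (perm g))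
  where
  sections : ∀ i → sec (g ∙ ε) i ≡ sec g i
  sections i = trans (sec-∙ g ε i) (trans (cong (sec g i ∙_) (sec-ε (app (perm g) i))) (∙-identityʳ (sec g i)))

⁻¹-inverseˡ : ∀ {n} (g : Aut n) → g ⁻¹ ∙ g ≡ ε
⁻¹-inverseˡ {zero} _ = refl
⁻¹-inverseˡ {suc n} g = node-ext sections (inv₃-∘₃ (perm g))
  where
  sections : ∀ i → sec (g ⁻¹ ∙ g) i ≡ sec ε i
  sections i = trans (sec-∙ (g ⁻¹) g i)
    (trans (cong (_∙ sec g (app (inv₃ (perm g)) i)) (sec-⁻¹ g i))
      (trans (⁻¹-inverseˡ _) (sym (sec-ε i))))

⁻¹-inverseʳ : ∀ {n} (g : Aut n) → g ∙ g ⁻¹ ≡ ε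
⁻¹-inverseʳ {zero} _ = refl
⁻¹-inverseʳ {suc n} g = node-ext sections (∘₃-inv₃ (perm g))
  where
  π : S3
  π = perm g
  sections : ∀ i → sec (g ∙ g ⁻¹) i ≡ sec ε i
  sections i = trans (sec-∙ g (g ⁻¹) i)
    (trans (cong (sec g i ∙_) (trans (sec-⁻¹ g (app π i)) (cong (λ j → sec g j ⁻¹) (app-inv₃ˡ π i))))
      (trans (⁻¹-inverseʳ _) (sym (sec-ε i))))

Aut-group : ℕ → Group 0ℓ 0ℓ
Aut-group n = record
  { Carrier = Aut n
  ; _≈_ = _≡_
  ; _∙_ = _∙_
  ; ε = ε
  ; _⁻¹ = _⁻¹
  ; isGroup = record
    { isMonoid = record
      { isSemigroup = record
        { isMagma = record { isEquivalence = isEquivalence ; ∙-cong = cong₂ _∙_ }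
        ; assoc = ∙-assoc }
      ; identity = ∙-identityˡ , ∙-identityʳ }
    ; inverse = ⁻¹-inverseˡ , ⁻¹-inverseʳ
    ; ⁻¹-cong = cong _⁻¹ } }

module AutGroup {n : ℕ} = GroupProperties (Aut-group n)
module AutMonoid {n : ℕ} = MonoidProperties (Group.monoid (Aut-group n))

open AutGroup using (ε⁻¹≈ε; ⁻¹-anti-homo-∙; ⁻¹-involutive; inverseʳ-unique; \\-leftDividesˡ; //-rightDividesˡ)
open AutMonoid using (ε-comm; cancelᶜ)

infixl 8 _^_

_^_ : ∀ {n} → Aut n → Aut n → Aut n
_^_ {n} = conj n

module _ {n : ℕ} where
  open ≡-Reasoning

  ^-ε : (s : Aut n) → s ^ ε ≡ s
  ^-ε s = begin
    (ε ⁻¹ ∙ s) ∙ ε ≡⟨ ∙-identityʳ _ ⟩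
    ε ⁻¹ ∙ s       ≡⟨ cong (_∙ s) ε⁻¹≈ε ⟩
    ε ∙ s          ≡⟨ ∙-identityˡ s ⟩
    s              ∎

  ε-^ : (g : Aut n) → ε ^ g ≡ ε
  ε-^ g = trans (cong (_∙ g) (∙-identityʳ (g ⁻¹))) (⁻¹-inverseˡ g)

  ^-self : (g : Aut n) → g ^ g ≡ g
  ^-self g = trans (cong (_∙ g) (⁻¹-inverseˡ g)) (∙-identityˡ g)

  ^-∙ : (a b g : Aut n) → (a ∙ b) ^ g ≡ a ^ g ∙ b ^ g
  ^-∙ a b g = begin
    (g ⁻¹ ∙ (a ∙ b)) ∙ g                   ≡⟨ cong (_∙ g) (∙-assoc _ a b) ⟨
    ((g ⁻¹ ∙ a) ∙ b) ∙ g                   ≡⟨ ∙-assoc _ b g ⟩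
    (g ⁻¹ ∙ a) ∙ (b ∙ g)                   ≡⟨ cancelᶜ (⁻¹-inverseʳ g) _ _ ⟨
    ((g ⁻¹ ∙ a) ∙ g) ∙ (g ⁻¹ ∙ (b ∙ g))    ≡⟨ cong (a ^ g ∙_) (∙-assoc _ b g) ⟨
    a ^ g ∙ b ^ g                          ∎

  ^-⁻¹ : (a g : Aut n) → a ⁻¹ ^ g ≡ (a ^ g) ⁻¹
  ^-⁻¹ a g = inverseʳ-unique (a ^ g) (a ⁻¹ ^ g) (begin
    a ^ g ∙ a ⁻¹ ^ g ≡⟨ ^-∙ a (a ⁻¹) g ⟨
    (a ∙ a ⁻¹) ^ g   ≡⟨ cong (_^ g) (⁻¹-inverseʳ a) ⟩
    ε ^ g            ≡⟨ ε-^ g ⟩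
    ε                ∎)

  ^-^ : (s g h : Aut n) → s ^ (g ∙ h) ≡ s ^ g ^ h
  ^-^ s g h = begin
    ((g ∙ h) ⁻¹ ∙ s) ∙ (g ∙ h)          ≡⟨ cong (λ u → (u ∙ s) ∙ (g ∙ h)) (⁻¹-anti-homo-∙ g h) ⟩
    ((h ⁻¹ ∙ g ⁻¹) ∙ s) ∙ (g ∙ h)       ≡⟨ ∙-assoc _ g h ⟨
    (((h ⁻¹ ∙ g ⁻¹) ∙ s) ∙ g) ∙ h       ≡⟨ cong (λ u → (u ∙ g) ∙ h) (∙-assoc _ _ s) ⟩
    ((h ⁻¹ ∙ (g ⁻¹ ∙ s)) ∙ g) ∙ h       ≡⟨ cong (_∙ h) (∙-assoc _ _ g) ⟩
    (h ⁻¹ ∙ ((g ⁻¹ ∙ s) ∙ g)) ∙ h       ∎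

record IsSubgroup {n : ℕ} (S : Pred n) : Set where
  field
    ε∈ : S ε
    ∙-closed : ∀ {g h} → S g → S h → S (g ∙ h)
    ⁻¹-closed : ∀ {g} → S g → S (g ⁻¹)

Gen-isSubgroup : ∀ {n} {T : Pred n} → IsSubgroup (Gen T)
Gen-isSubgroup = record { ε∈ = gone ; ∙-closed = gmul ; ⁻¹-closed = ginv }

Gen-least : ∀ {n} {S T : Pred n} → IsSubgroup S → T ⊆ S → Gen T ⊆ S
Gen-least S-sub T⊆S (gen t∈T) = T⊆S t∈T
Gen-least S-sub T⊆S gone = IsSubgroup.ε∈ S-sub
Gen-least S-sub T⊆S (gmul g∈ h∈) = IsSubgroup.∙-closed S-sub (Gen-least S-sub T⊆S g∈) (Gen-least S-sub T⊆S h∈)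
Gen-least S-sub T⊆S (ginv g∈) = IsSubgroup.⁻¹-closed S-sub (Gen-least S-sub T⊆S g∈)

ConjPreimage : ∀ {n} → Pred n → Aut n → Pred n
ConjPreimage S g s = S (s ^ g)

Normalizer : ∀ {n} → Pred n → Pred n
Normalizer S g = S ⊆ ConjPreimage S g × S ⊆ ConjPreimage S (g ⁻¹)

module _ {n : ℕ} {S : Pred n} where

  ConjPreimage-isSubgroup : IsSubgroup S → ∀ g → IsSubgroup (ConjPreimage S g)
  ConjPreimage-isSubgroup S-sub g = record
    { ε∈ = subst S (sym (ε-^ g)) ε∈
    ; ∙-closed = λ {a} {b} a∈ b∈ → subst S (sym (^-∙ a b g)) (∙-closed a∈ b∈)
    ; ⁻¹-closed = λ {a} a∈ → subst S (sym (^-⁻¹ a g)) (⁻¹-closed a∈)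
    }
    where open IsSubgroup S-sub

  Normalizer-isSubgroup : IsSubgroup (Normalizer S)
  Normalizer-isSubgroup = record
    { ε∈ = (λ {s} s∈ → subst S (sym (^-ε s)) s∈)
         , (λ {s} s∈ → subst S (sym (trans (cong (s ^_) ε⁻¹≈ε) (^-ε s))) s∈)
    ; ∙-closed = λ {g} {h} (g⁺ , g⁻) (h⁺ , h⁻) →
          (λ {s} s∈ → subst S (sym (^-^ s g h)) (h⁺ (g⁺ s∈)))
        , (λ {s} s∈ → subst S (sym (trans (cong (s ^_) (⁻¹-anti-homo-∙ g h)) (^-^ s (h ⁻¹) (g ⁻¹))))
                              (g⁻ (h⁻ s∈)))
    ; ⁻¹-closed = λ {g} (g⁺ , g⁻) → g⁻ , subst (λ u → S ⊆ ConjPreimage S u) (sym (⁻¹-involutive g)) g⁺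
    }

  ⊆-Normalizer : IsSubgroup S → S ⊆ Normalizer S
  ⊆-Normalizer S-sub g∈ = (λ s∈ → ∙-closed (∙-closed (⁻¹-closed g∈) s∈) g∈)
                        , (λ s∈ → ∙-closed (∙-closed (⁻¹-closed (⁻¹-closed g∈)) s∈) (⁻¹-closed g∈))
    where open IsSubgroup S-sub

  Normalizer-from-square : IsSubgroup S → ∀ {g} → S ⊆ ConjPreimage S g → S (g ∙ g) → Normalizer S g
  Normalizer-from-square S-sub {g} g⁺ gg∈ = g⁺ , λ {s} s∈ →
    subst S (sym (conj-by-inverse s)) (proj₂ (⊆-Normalizer S-sub gg∈) (g⁺ s∈))
    where
    conj-by-inverse : ∀ s → s ^ g ⁻¹ ≡ s ^ g ^ (g ∙ g) ⁻¹
    conj-by-inverse s = trans (cong (s ^_) inverse-via-square) (^-^ s g ((g ∙ g) ⁻¹))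
      where
      inverse-via-square : g ⁻¹ ≡ g ∙ (g ∙ g) ⁻¹
      inverse-via-square = sym (trans (cong (g ∙_) (⁻¹-anti-homo-∙ g g)) (\\-leftDividesˡ g (g ⁻¹)))

SectionsIn : ∀ {n} → Pred n → Pred (suc n)
SectionsIn S g = ∀ i → S (sec g i)

sections-node : ∀ {n} (S : Pred n) {a b c π} → S a → S b → S c → SectionsIn S (node a b c π)
sections-node _ a∈ b∈ c∈ zero = a∈
sections-node _ a∈ b∈ c∈ (suc zero) = b∈
sections-node _ a∈ b∈ c∈ (suc (suc zero)) = c∈

SectionsIn-isSubgroup : ∀ {n} {S : Pred n} → IsSubgroup S → IsSubgroup (SectionsIn S)
SectionsIn-isSubgroup {S = S} S-sub = record
  { ε∈ = λ i → subst S (sym (sec-ε i)) ε∈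
  ; ∙-closed = λ {g} {h} g∈ h∈ i → subst S (sym (sec-∙ g h i)) (∙-closed (g∈ i) (h∈ (app (perm g) i)))
  ; ⁻¹-closed = λ {g} g∈ i → subst S (sym (sec-⁻¹ g i)) (⁻¹-closed (g∈ (app (inv₃ (perm g)) i)))
  }
  where open IsSubgroup S-sub

Product³ : ∀ {n} → Pred n → Pred (suc n)
Product³ S g = perm g ≡ e × SectionsIn S g

Product³-isSubgroup : ∀ {n} {S : Pred n} → IsSubgroup S → IsSubgroup (Product³ S)
Product³-isSubgroup S-sub = record
  { ε∈ = refl , ε∈
  ; ∙-closed = λ (p , g∈) (q , h∈) → cong₂ _∘₃_ p q , ∙-closed g∈ h∈
  ; ⁻¹-closed = λ (p , g∈) → cong inv₃ p , ⁻¹-closed g∈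
  }
  where open IsSubgroup (SectionsIn-isSubgroup S-sub)

module _ {n : ℕ} where
  open ≡-Reasoning

  sec-^ : ∀ (d h : Aut (suc n)) → perm d ≡ e → ∀ i →
    let j = app (inv₃ (perm h)) i in sec (d ^ h) i ≡ sec d j ^ sec h j
  sec-^ d h refl i = begin
    sec ((h ⁻¹ ∙ d) ∙ h) i                       ≡⟨ sec-∙ (h ⁻¹ ∙ d) h i ⟩
    sec (h ⁻¹ ∙ d) i ∙ sec h (app (π⁻¹ ∘₃ e) i)
      ≡⟨ cong₂ _∙_ (sec-∙ (h ⁻¹) d i) (cong (sec h) (app-∘₃ π⁻¹ e i)) ⟩
    (sec (h ⁻¹) i ∙ sec d j) ∙ sec h j          ≡⟨ cong (λ u → (u ∙ sec d j) ∙ sec h j) (sec-⁻¹ h i) ⟩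
    (sec h j ⁻¹ ∙ sec d j) ∙ sec h j            ∎
    where
    π⁻¹ : S3
    π⁻¹ = inv₃ (perm h)
    j : Fin 3
    j = app π⁻¹ i

  perm-^ : ∀ (d h : Aut (suc n)) → perm d ≡ e → perm (d ^ h) ≡ e
  perm-^ d h refl = trans (cong (_∘₃ perm h) (∘₃-e _)) (inv₃-∘₃ (perm h))

Product³-^ : ∀ {n} {S : Pred n} {d h} → Product³ S d → SectionsIn (Normalizer S) h → Product³ S (d ^ h)
Product³-^ {S = S} {d} {h} (d-fixes , d∈) h-normalizes = perm-^ d h d-fixes , λ i →
  let j = app (inv₃ (perm h)) i in
  subst S (sym (sec-^ d h d-fixes i)) (proj₁ (h-normalizes j) (d∈ j))

cong-node : ∀ {A : Set} {a b c a′ b′ c′ : A} {π} →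
  a ≡ a′ → b ≡ b′ → c ≡ c′ → node a b c π ≡ node a′ b′ c′ π
cong-node refl refl refl = refl

embAt : ∀ {n} → Fin 3 → Aut n → Aut (suc n)
embAt zero s = node s ε ε e
embAt (suc zero) s = node ε s ε e
embAt (suc (suc zero)) s = node ε ε s e

EmbAt : ∀ {n} → Fin 3 → Pred n → Pred (suc n)
EmbAt i S g = ∃[ s ] (S s × g ≡ embAt i s)

emb-^ : ∀ {n} (s : Aut n) h → emb n s ^ h ≡ embAt (app (perm h) zero) (s ^ sec h zero)
emb-^ s (node h₀ h₁ h₂ e) = cong-node refl (ε-^ h₁) (ε-^ h₂)
emb-^ s (node h₀ h₁ h₂ r) = cong-node (ε-^ h₂) refl (ε-^ h₁)
emb-^ s (node h₀ h₁ h₂ r²) = cong-node (ε-^ h₁) (ε-^ h₂) refl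
emb-^ s (node h₀ h₁ h₂ t01) = cong-node (ε-^ h₁) refl (ε-^ h₂)
emb-^ s (node h₀ h₁ h₂ t02) = cong-node (ε-^ h₂) (ε-^ h₁) refl
emb-^ s (node h₀ h₁ h₂ t12) = cong-node refl (ε-^ h₂) (ε-^ h₁)

embAt-product : ∀ {n} (a b c : Aut n) → embAt zero a ∙ embAt (suc zero) b ∙ embAt (suc (suc zero)) c ≡ node a b c e
embAt-product a b c = cong-node (trans (∙-identityʳ _) (∙-identityʳ a))
                                (trans (∙-identityʳ _) (∙-identityˡ b))
                                (trans (cong (_∙ c) (∙-identityˡ ε)) (∙-identityˡ c))

embAt-comm : ∀ {n} {i j} → i ≢ j → (s t : Aut n) → embAt i s ∙ embAt j t ≡ embAt j t ∙ embAt i s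
embAt-comm {i = zero} {zero} i≢j = ⊥-elim (i≢j refl)
embAt-comm {i = zero} {suc zero} _ s t = cong-node (ε-comm s) (sym (ε-comm t)) refl
embAt-comm {i = zero} {suc (suc zero)} _ s t = cong-node (ε-comm s) refl (sym (ε-comm t))
embAt-comm {i = suc zero} {zero} _ s t = cong-node (sym (ε-comm t)) (ε-comm s) refl
embAt-comm {i = suc zero} {suc zero} i≢j = ⊥-elim (i≢j refl)
embAt-comm {i = suc zero} {suc (suc zero)} _ s t = cong-node refl (ε-comm s) (sym (ε-comm t))
embAt-comm {i = suc (suc zero)} {zero} _ s t = cong-node (sym (ε-comm t)) refl (ε-comm s)
embAt-comm {i = suc (suc zero)} {suc zero} _ s t = cong-node refl (sym (ε-comm t)) (ε-comm s)
embAt-comm {i = suc (suc zero)} {suc (suc zero)} i≢j = ⊥-elim (i≢j refl)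

EmbAt-comm : ∀ {n} {S T : Pred n} i j {a b} → i ≢ j → EmbAt i S a → EmbAt j T b → a ∙ b ≡ b ∙ a
EmbAt-comm _ _ i≢j (s , _ , refl) (t , _ , refl) = embAt-comm i≢j s t

EmbAt-product-injective : ∀ {n} {S : Pred n} {a b c a′ b′ c′} →
  EmbAt zero S a → EmbAt (suc zero) S b → EmbAt (suc (suc zero)) S c →
  EmbAt zero S a′ → EmbAt (suc zero) S b′ → EmbAt (suc (suc zero)) S c′ →
  (a ∙ b) ∙ c ≡ (a′ ∙ b′) ∙ c′ → (a ≡ a′) × (b ≡ b′) × (c ≡ c′)
EmbAt-product-injective (s , _ , refl) (t , _ , refl) (u , _ , refl) (s′ , _ , refl) (t′ , _ , refl) (u′ , _ , refl) eq =
  cong (embAt zero ∘ s₀) nodes≡ ,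
  cong (embAt (suc zero) ∘ s₁) nodes≡ ,
  cong (embAt (suc (suc zero)) ∘ s₂) nodes≡
  where
  nodes≡ : node s t u e ≡ node s′ t′ u′ e
  nodes≡ = trans (sym (embAt-product s t u)) (trans eq (embAt-product s′ t′ u′))

emb-^-x : ∀ m (s : Aut m) → emb m s ^ xₛ m ≡ embAt (suc zero) s
emb-^-x zero s = refl
emb-^-x (suc m) s = trans (emb-^ s (xₛ (suc m))) (cong (embAt (suc zero)) (^-ε s))

emb-^-xx : ∀ m (s : Aut m) → emb m s ^ (xₛ m ∙ xₛ m) ≡ embAt (suc (suc zero)) s
emb-^-xx zero s = refl
emb-^-xx (suc m) s = trans (emb-^ s (xₛ (suc m) ∙ xₛ (suc m)))
                           (cong (embAt (suc (suc zero))) (trans (cong (s ^_) (∙-identityˡ ε)) (^-ε s)))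

ConjSub-x⊆EmbAt₁ : ∀ {m} {S : Pred m} → ConjSub (Emb S) (xₛ m) ⊆ EmbAt (suc zero) S
ConjSub-x⊆EmbAt₁ {m} (_ , (s , s∈ , refl) , refl) = s , s∈ , emb-^-x m s

ConjSub-xx⊆EmbAt₂ : ∀ {m} {S : Pred m} → ConjSub (Emb S) (xₛ m ∙ xₛ m) ⊆ EmbAt (suc (suc zero)) S
ConjSub-xx⊆EmbAt₂ {m} (_ , (s , s∈ , refl) , refl) = s , s∈ , emb-^-xx m s

node-factorization : ∀ m (a b c : Aut m) → node a b c e ≡ emb m a ∙ emb m b ^ xₛ m ∙ emb m c ^ (xₛ m ∙ xₛ m)
node-factorization m a b c =
  sym (trans (cong₂ (λ u v → emb m a ∙ u ∙ v) (emb-^-x m b) (emb-^-xx m c)) (embAt-product a b c))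

Product³-factorization : ∀ m {S : Pred m} {g} → Product³ S g →
  ∃[ a ] ∃[ b ] ∃[ c ]
    (Emb S a × ConjSub (Emb S) (xₛ m) b × ConjSub (Emb S) (xₛ m ∙ xₛ m) c × g ≡ a ∙ b ∙ c)
Product³-factorization m {g = node a b c .e} (refl , g-sections) =
  emb m a , emb m b ^ xₛ m , emb m c ^ (xₛ m ∙ xₛ m) ,
  (a , g-sections zero , refl) ,
  (emb m b , (b , g-sections (suc zero) , refl) , refl) ,
  (emb m c , (c , g-sections (suc (suc zero)) , refl) , refl) ,
  node-factorization m a b c

LGen : (m : ℕ) → Pred (suc m)
LGen m g = (g ≡ xₛ m) ⊎ (g ≡ zₛ m) ⊎ Emb (L m) g

L-isSubgroup : ∀ m → IsSubgroup (L m)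
L-isSubgroup zero = Gen-isSubgroup
L-isSubgroup (suc m) = Gen-isSubgroup

ε∈L : ∀ m → L m ε
ε∈L m = IsSubgroup.ε∈ (L-isSubgroup m)

L⊆Normalizer : ∀ m → L m ⊆ Normalizer (L m)
L⊆Normalizer m = ⊆-Normalizer (L-isSubgroup m)

x∈L : ∀ m → L (suc m) (xₛ m)
x∈L m = gen (inj₁ refl)

z∈L : ∀ m → L (suc m) (zₛ m)
z∈L m = gen (inj₂ (inj₁ refl))

emb∈L : ∀ m {s} → L m s → L (suc m) (emb m s)
emb∈L m {s} s∈ = gen (inj₂ (inj₂ (s , s∈ , refl)))

node∈L : ∀ m {a b c} → L m a → L m b → L m c → L (suc m) (node a b c e)
node∈L m a∈ b∈ c∈ = subst (L (suc m)) (sym (node-factorization m _ _ _))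
  (gmul (gmul (emb∈L m a∈) (proj₁ (L⊆Normalizer (suc m) (x∈L m)) (emb∈L m b∈)))
        (proj₁ (L⊆Normalizer (suc m) (gmul (x∈L m) (x∈L m))) (emb∈L m c∈)))

module _ (j : ℕ) where
  open ≡-Reasoning
  private
    x y : Aut (suc j)
    x = xₛ j
    y = yₛ j
    X Y Z : Aut (suc (suc j))
    X = xₛ (suc j)
    Y = yₛ (suc j)
    Z = zₛ (suc j)

  y²-factorization : Y ∙ Y ≡ Z ∙ node ε ε x e
  y²-factorization = cong-node (sym (ε-comm y)) refl refl

  z^y : Z ^ Y ≡ Z
  z^y = cong-node (^-self y) (^-ε y) (^-self x)

  -- The middle factor has its sections in L because y ∙ y does, although y need not.
  x^y : X ^ Y ≡ Z ∙ node ((y ∙ y) ⁻¹ ∙ x) (x ⁻¹) ((x ∙ x) ⁻¹) e ∙ (X ∙ X)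
  x^y = cong-node section₀ section₁ section₂
    where
    section₀ : (y ⁻¹ ∙ ε) ∙ x ≡ (y ∙ ((y ∙ y) ⁻¹ ∙ x)) ∙ (ε ∙ ε)
    section₀ = begin
      (y ⁻¹ ∙ ε) ∙ x                   ≡⟨ cong (_∙ x) (∙-identityʳ _) ⟩
      y ⁻¹ ∙ x                         ≡⟨ \\-leftDividesˡ y (y ⁻¹ ∙ x) ⟨
      y ∙ (y ⁻¹ ∙ (y ⁻¹ ∙ x))          ≡⟨ cong (y ∙_) (∙-assoc _ _ x) ⟨
      y ∙ ((y ⁻¹ ∙ y ⁻¹) ∙ x)          ≡⟨ cong (λ u → y ∙ (u ∙ x)) (⁻¹-anti-homo-∙ y y) ⟨
      y ∙ ((y ∙ y) ⁻¹ ∙ x)             ≡⟨ ∙-identityʳ _ ⟨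
      (y ∙ ((y ∙ y) ⁻¹ ∙ x)) ∙ ε       ≡⟨ cong ((y ∙ ((y ∙ y) ⁻¹ ∙ x)) ∙_) (∙-identityˡ ε) ⟨
      (y ∙ ((y ∙ y) ⁻¹ ∙ x)) ∙ (ε ∙ ε) ∎
    section₁ : (ε ⁻¹ ∙ ε) ∙ y ≡ (y ∙ x ⁻¹) ∙ (ε ∙ x)
    section₁ = begin
      (ε ⁻¹ ∙ ε) ∙ y      ≡⟨ cong (_∙ y) (⁻¹-inverseˡ ε) ⟩
      ε ∙ y               ≡⟨ ∙-identityˡ y ⟩
      y                   ≡⟨ //-rightDividesˡ x y ⟨
      (y ∙ x ⁻¹) ∙ x      ≡⟨ cong (y ∙ x ⁻¹ ∙_) (∙-identityˡ x) ⟨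
      (y ∙ x ⁻¹) ∙ (ε ∙ x) ∎
    section₂ : (x ⁻¹ ∙ x) ∙ ε ≡ (x ∙ (x ∙ x) ⁻¹) ∙ (x ∙ ε)
    section₂ = begin
      (x ⁻¹ ∙ x) ∙ ε             ≡⟨ ∙-identityʳ _ ⟩
      x ⁻¹ ∙ x                   ≡⟨ cong (_∙ x) (\\-leftDividesˡ x (x ⁻¹)) ⟨
      (x ∙ (x ⁻¹ ∙ x ⁻¹)) ∙ x    ≡⟨ cong (λ u → (x ∙ u) ∙ x) (⁻¹-anti-homo-∙ x x) ⟨
      (x ∙ (x ∙ x) ⁻¹) ∙ x       ≡⟨ cong (x ∙ (x ∙ x) ⁻¹ ∙_) (∙-identityʳ x) ⟨
      (x ∙ (x ∙ x) ⁻¹) ∙ (x ∙ ε) ∎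

y²∈L : ∀ k → L (suc k) (yₛ k ∙ yₛ k)
y²∈L zero = gone
y²∈L (suc j) = subst (L (suc (suc j))) (sym (y²-factorization j))
  (gmul (z∈L (suc j)) (node∈L (suc j) (ε∈L (suc j)) (ε∈L (suc j)) (x∈L j)))

LGen^y⊆L : ∀ k → LGen k ⊆ ConjPreimage (L (suc k)) (yₛ k)
LGen^y⊆L zero (inj₁ refl) = gmul (x∈L 0) (x∈L 0)
LGen^y⊆L zero (inj₂ (inj₁ refl)) = gone
LGen^y⊆L zero (inj₂ (inj₂ (_ , _ , refl))) = gone
LGen^y⊆L (suc j) (inj₁ refl) = subst (L (suc (suc j))) (sym (x^y j))
  (gmul (gmul (z∈L (suc j)) middle∈L) (gmul (x∈L (suc j)) (x∈L (suc j))))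
  where
  middle∈L : L (suc (suc j)) (node ((yₛ j ∙ yₛ j) ⁻¹ ∙ xₛ j) (xₛ j ⁻¹) ((xₛ j ∙ xₛ j) ⁻¹) e)
  middle∈L = node∈L (suc j) (gmul (ginv (y²∈L j)) (x∈L j)) (ginv (x∈L j)) (ginv (gmul (x∈L j) (x∈L j)))
LGen^y⊆L (suc j) (inj₂ (inj₁ refl)) = subst (L (suc (suc j))) (sym (z^y j)) (z∈L (suc j))
LGen^y⊆L (suc j) (inj₂ (inj₂ (t , t∈ , refl))) =
  subst (L (suc (suc j))) (sym (trans (emb-^ t (yₛ (suc j))) (cong (embAt (suc zero)) (^-ε t))))
    (node∈L (suc j) (ε∈L (suc j)) t∈ (ε∈L (suc j)))

y-normalizes-L : ∀ k → Normalizer (L (suc k)) (yₛ k)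
y-normalizes-L k = Normalizer-from-square L-sub
  (Gen-least (ConjPreimage-isSubgroup L-sub (yₛ k)) (LGen^y⊆L k))
  (y²∈L k)
  where
  L-sub : IsSubgroup (L (suc k))
  L-sub = L-isSubgroup (suc k)

LGen-sections-normalize : ∀ m → LGen m ⊆ SectionsIn (Normalizer (L m))
LGen-sections-normalize zero _ _ = (λ _ → gone) , (λ _ → gone)
LGen-sections-normalize (suc k) = λ where
    (inj₁ refl) → sections-node N (member gone) (member gone) (member (x∈L k))
    (inj₂ (inj₁ refl)) → sections-node N (y-normalizes-L k) (y-normalizes-L k) (member (x∈L k))
    (inj₂ (inj₂ (t , t∈ , refl))) → sections-node N (member t∈) (member gone) (member gone)
  where
  N : Pred (suc k)
  N = Normalizer (L (suc k))
  member : L (suc k) ⊆ N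
  member = L⊆Normalizer (suc k)

L-sections-normalize : ∀ m → L (suc m) ⊆ SectionsIn (Normalizer (L m))
L-sections-normalize m = Gen-least (SectionsIn-isSubgroup Normalizer-isSubgroup) (LGen-sections-normalize m)

H⊆Product³ : ∀ m → H m ⊆ Product³ (L m)
H⊆Product³ m = Gen-least (Product³-isSubgroup (L-isSubgroup m)) λ where
  (_ , h , (t , t∈ , refl) , h∈ , refl) →
    Product³-^ (refl , sections-node (L m) t∈ (ε∈L m) (ε∈L m)) (L-sections-normalize m h∈)

theorem3p9 : (m : ℕ) →
    IsInternalDirectProduct3 (H m)
      (Emb (L m))
      (ConjSub (Emb (L m)) (xₛ m))
      (ConjSub (Emb (L m)) (mulA (suc m) (xₛ m) (xₛ m)))
theorem3p9 m = record
  { A⊆G = λ {a} a∈ → gen (a , ε , a∈ , gone , sym (^-ε a))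
  ; B⊆G = λ (s , s∈ , b≡) → gen (s , xₛ m , s∈ , x∈L m , b≡)
  ; C⊆G = λ (s , s∈ , c≡) → gen (s , xₛ m ∙ xₛ m , s∈ , gmul (x∈L m) (x∈L m) , c≡)
  ; commAB = λ a∈ b∈ → EmbAt-comm zero (suc zero) (λ ()) a∈ (ConjSub-x⊆EmbAt₁ b∈)
  ; commAC = λ a∈ c∈ → EmbAt-comm zero (suc (suc zero)) (λ ()) a∈ (ConjSub-xx⊆EmbAt₂ c∈)
  ; commBC = λ b∈ c∈ →
      EmbAt-comm (suc zero) (suc (suc zero)) (λ ()) (ConjSub-x⊆EmbAt₁ b∈) (ConjSub-xx⊆EmbAt₂ c∈)
  ; decomp = λ g∈ → Product³-factorization m (H⊆Product³ m g∈)
  ; unique = λ a∈ b∈ c∈ a′∈ b′∈ c′∈ → EmbAt-product-injective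
      a∈ (ConjSub-x⊆EmbAt₁ b∈) (ConjSub-xx⊆EmbAt₂ c∈)
      a′∈ (ConjSub-x⊆EmbAt₁ b′∈) (ConjSub-xx⊆EmbAt₂ c′∈)
  }
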